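{- Let $t$ be a positive integer and let $x_i,y_i$ be nonnegative integers for all $i\in[t]$. If $k=\sum_{i\in [t]}(-1)^{x_i}2^{y_i} \geq 1$, then $bl(k)\leq t$.
   Context: The block binary representation of a positive integer $k$ is the unique way of writing its binary representation as $\mathbf{1}_{q_b}\mathbf{0}_{l_b}\cdots\mathbf{1}_{q_2}\mathbf{0}_{l_2}\mathbf{1}_{q_1}\mathbf{0}_{l_1}$, where $\mathbf{1}_q$ (resp. $\mathbf{0}_l$) denotes a string of $q$ ones (resp. $l$ zeros), $q_i>0$ for all $i\in[b]$, $l_j>0$ for all $j\in[2,b]$, and $l_1\geq 0$; the block count of $k$ is $bl(k)=b$ (the number of maximal runs of consecutive 1's in binary). -}

module Defs where

open import Data.Nat using (ℕ; zero; suc; _+_; _*_; _^_; _%_; _/_)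
open import Data.Bool using (Bool; true; false)
open import Data.List using (List; []; _∷_)
open import Data.Integer using (ℤ; +_; -_)
open import Data.Fin using (Fin)
open import Data.Fin using () renaming (zero to fz; suc to fs)

-- Binary digits of n, least significant first (no leading zeros: toBits 0 = []).
-- Uses fuel (n itself suffices since n / 2 < n for n > 0).
toBitsFuel : ℕ → ℕ → List Bool
toBitsFuel zero    _       = []
toBitsFuel (suc f) zero    = []
toBitsFuel (suc f) (suc n) = bit ∷ toBitsFuel f (suc n / 2)
  where
  bit : Bool
  bit with suc n % 2
  ... | zero = false
  ... | suc _ = true

toBits : ℕ → List Bool
toBits n = toBitsFuel n n

runsOfOnes : List Bool → ℕ
runsOfOnes []                  = 0
runsOfOnes (true ∷ [])         = 1
runsOfOnes (true ∷ false ∷ bs) = suc (runsOfOnes (false ∷ bs))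
runsOfOnes (true ∷ true ∷ bs)  = runsOfOnes (true ∷ bs)
runsOfOnes (false ∷ bs)        = runsOfOnes bs

-- block count bl(k): number of maximal runs of 1's in the binary representation of k
bl : ℕ → ℕ
bl k = runsOfOnes (toBits k)

negOnePow : ℕ → ℤ
negOnePow zero    = + 1
negOnePow (suc x) = - negOnePow x

sumFin : (t : ℕ) → (Fin t → ℤ) → ℤ
sumFin zero    f = + 0
sumFin (suc t) f = f fz Data.Integer.+ sumFin t (λ i → f (fs i))

signedPowSum : (t : ℕ) → (Fin t → ℕ) → (Fin t → ℕ) → ℤ
signedPowSum t x y = sumFin t (λ i → negOnePow (x i) Data.Integer.* (+ (2 ^ y i)))

-- Adding 2^y to m changes the bits of m only on the carry chain starting at position y, where a
-- run 1…10 becomes 0…01; this creates, destroys, merges or splits at most one block, so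
-- |bl (m + 2^y) - bl m| ≤ 1.  Formally this follows by induction on y and on the binary expansion
-- of m from the recurrences bl (2n) = bl n, bl (4n+1) = bl n + 1 and bl (4n+3) = bl (2n+1).
-- Reading k = Σ ±2^(y_i) as t such steps starting from 0 gives bl k ≤ bl 0 + t = t.
module Submission where

open import Defs
open import Data.Nat using (ℕ; _≤_; _≥_)
open import Data.Fin using (Fin)
open import Data.Integer using (ℤ; +_)
open import Relation.Binary.PropositionalEquality using (_≡_)

open import Data.Bool using (Bool; true; false)
open import Data.List using (_∷_)
open import Data.Nat using (zero; suc; _+_; _*_; _^_; _%_; _/_; z≤n; s≤s)
open import Data.Nat.Properties
open import Data.Nat.DivMod using (m*n%n≡0; m*n/n≡m; [m+kn]%n≡m%n; +-distrib-/-∣ʳ; m/n<m)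
open import Data.Nat.Divisibility using (n∣m*n)
open import Data.Product using (_×_; _,_)
open import Data.Sum using (_⊎_; inj₁; inj₂)
open import Data.Fin using () renaming (zero to fz; suc to fs)
open import Function using (_∘_)
open import Relation.Binary.PropositionalEquality using (refl; sym; trans; cong; cong₂; subst; module ≡-Reasoning)
import Data.Integer as ℤ
import Data.Integer.Properties as ℤ
open import Data.Integer.Solver using (module +-*-Solver)

bitOf : ℕ → Bool
bitOf zero    = false
bitOf (suc _) = true

toBitsFuel-suc : ∀ f n → toBitsFuel (suc f) (suc n) ≡ bitOf (suc n % 2) ∷ toBitsFuel f (suc n / 2)
toBitsFuel-suc f n with suc n % 2
... | zero  = refl
... | suc _ = refl

[1+n]/2≤n : ∀ n → suc n / 2 ≤ n
[1+n]/2≤n n = ≤-pred (m/n<m (suc n) 2 (s≤s (s≤s z≤n)))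

toBitsFuel-irrelevant : ∀ {f g} n → n ≤ f → n ≤ g → toBitsFuel f n ≡ toBitsFuel g n
toBitsFuel-irrelevant {zero}  {zero}  zero _ _ = refl
toBitsFuel-irrelevant {zero}  {suc g} zero _ _ = refl
toBitsFuel-irrelevant {suc f} {zero}  zero _ _ = refl
toBitsFuel-irrelevant {suc f} {suc g} zero _ _ = refl
toBitsFuel-irrelevant {suc f} {suc g} (suc n) (s≤s n≤f) (s≤s n≤g) = begin
  toBitsFuel (suc f) (suc n)                   ≡⟨ toBitsFuel-suc f n ⟩
  bitOf (suc n % 2) ∷ toBitsFuel f (suc n / 2)
    ≡⟨ cong (_ ∷_) (toBitsFuel-irrelevant _ (half≤ n≤f) (half≤ n≤g)) ⟩
  bitOf (suc n % 2) ∷ toBitsFuel g (suc n / 2) ≡⟨ sym (toBitsFuel-suc g n) ⟩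
  toBitsFuel (suc g) (suc n)                   ∎
  where
  open ≡-Reasoning
  half≤ : ∀ {h} → n ≤ h → suc n / 2 ≤ h
  half≤ = ≤-trans ([1+n]/2≤n n)

toBits-suc : ∀ n → toBits (suc n) ≡ bitOf (suc n % 2) ∷ toBits (suc n / 2)
toBits-suc n = trans (toBitsFuel-suc n n)
  (cong (bitOf (suc n % 2) ∷_) (toBitsFuel-irrelevant _ ([1+n]/2≤n n) ≤-refl))

toBits[2[1+n]] : ∀ n → toBits (suc n * 2) ≡ false ∷ toBits (suc n)
toBits[2[1+n]] n = trans (toBits-suc (suc (n * 2)))
  (cong₂ _∷_ (cong bitOf (m*n%n≡0 (suc n) 2)) (cong toBits (m*n/n≡m (suc n) 2)))

toBits[1+2n] : ∀ n → toBits (1 + n * 2) ≡ true ∷ toBits n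
toBits[1+2n] n = trans (toBits-suc (n * 2))
  (cong₂ _∷_ (cong bitOf ([m+kn]%n≡m%n 1 n 2)) (cong toBits [1+2n]/2≡n))
  where
  [1+2n]/2≡n : (1 + n * 2) / 2 ≡ n
  [1+2n]/2≡n = trans (+-distrib-/-∣ʳ 1 {d = 2} (n∣m*n n)) (m*n/n≡m n 2)

bl[2n]≡bl[n] : ∀ n → bl (n * 2) ≡ bl n
bl[2n]≡bl[n] zero    = refl
bl[2n]≡bl[n] (suc n) = cong runsOfOnes (toBits[2[1+n]] n)

bl[4n+1]≡1+bl[n] : ∀ n → bl (1 + n * 2 * 2) ≡ suc (bl n)
bl[4n+1]≡1+bl[n] zero    = refl
bl[4n+1]≡1+bl[n] (suc n) rewrite toBits[1+2n] (suc n * 2) | toBits[2[1+n]] n = refl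

bl[4n+3]≡bl[2n+1] : ∀ n → bl (1 + (1 + n * 2) * 2) ≡ bl (1 + n * 2)
bl[4n+3]≡bl[2n+1] n rewrite toBits[1+2n] (1 + n * 2) | toBits[1+2n] n = refl

-- Numbers are doubled as n * 2 because suc n * 2 reduces to suc (suc (n * 2)), keeping inc definitional.
data Binary : ℕ → Set where
  zero : Binary 0
  even : ∀ {n} → Binary n → Binary (n * 2)
  odd  : ∀ {n} → Binary n → Binary (1 + n * 2)

inc : ∀ {n} → Binary n → Binary (suc n)
inc zero     = odd zero
inc (even b) = odd b
inc (odd b)  = even (inc b)

binary : ∀ n → Binary n
binary zero    = zero
binary (suc n) = inc (binary n)

BlWithin : ℕ → ℕ → ℕ → Set
BlWithin d a b = bl a ≤ d + bl b × bl b ≤ d + bl a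

within-refl : ∀ a → BlWithin 0 a a
within-refl a = ≤-refl , ≤-refl

within-sym : ∀ {d a b} → BlWithin d a b → BlWithin d b a
within-sym (p , q) = q , p

within-trans : ∀ {d e a b c} → BlWithin d a b → BlWithin e b c → BlWithin (d + e) a c
within-trans {d} {e} {a} {b} {c} (ab , ba) (bc , cb) = ac , ca
  where
  open ≤-Reasoning
  ac : bl a ≤ d + e + bl c
  ac = begin
    bl a            ≤⟨ ab ⟩
    d + bl b        ≤⟨ +-monoʳ-≤ d bc ⟩
    d + (e + bl c)  ≡⟨ sym (+-assoc d e (bl c)) ⟩
    d + e + bl c    ∎
  ca : bl c ≤ d + e + bl a
  ca = begin
    bl c            ≤⟨ cb ⟩
    e + bl b        ≤⟨ +-monoʳ-≤ e ba ⟩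
    e + (d + bl a)  ≡⟨ sym (+-assoc e d (bl a)) ⟩
    e + d + bl a    ≡⟨ cong (_+ bl a) (+-comm e d) ⟩
    d + e + bl a    ∎

within-2n : ∀ {d a b} → BlWithin d a b → BlWithin d (a * 2) (b * 2)
within-2n {a = a} {b} w rewrite bl[2n]≡bl[n] a | bl[2n]≡bl[n] b = w

within-4n+1 : ∀ {d a b} → BlWithin d a b → BlWithin d (1 + a * 2 * 2) (1 + b * 2 * 2)
within-4n+1 {d} {a} {b} (ab , ba)
  rewrite bl[4n+1]≡1+bl[n] a | bl[4n+1]≡1+bl[n] b | +-suc d (bl a) | +-suc d (bl b) = s≤s ab , s≤s ba

within-4n+3 : ∀ {d a b} → BlWithin d (1 + a * 2) (1 + b * 2) →
              BlWithin d (1 + (1 + a * 2) * 2) (1 + (1 + b * 2) * 2)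
within-4n+3 {a = a} {b} w rewrite bl[4n+3]≡bl[2n+1] a | bl[4n+3]≡bl[2n+1] b = w

bl[2n+1]-between : ∀ {n} → Binary n → bl n ≤ bl (1 + n * 2) × bl (1 + n * 2) ≤ suc (bl n)
bl[2n+1]-between zero = z≤n , ≤-refl
bl[2n+1]-between (even {k} _) rewrite bl[4n+1]≡1+bl[n] k | bl[2n]≡bl[n] k = n≤1+n _ , ≤-refl
bl[2n+1]-between (odd {k} _) rewrite bl[4n+3]≡bl[2n+1] k = ≤-refl , n≤1+n _

bl[2n+1]-between-suc : ∀ {n} → Binary n → bl (suc n) ≤ bl (1 + n * 2) × bl (1 + n * 2) ≤ suc (bl (suc n))
bl[2n+1]-between-suc zero = ≤-refl , n≤1+n _
bl[2n+1]-between-suc (even {k} b) rewrite bl[4n+1]≡1+bl[n] k with bl[2n+1]-between b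
... | lower , upper = upper , s≤s lower
bl[2n+1]-between-suc (odd {k} b) rewrite bl[4n+3]≡bl[2n+1] k | bl[2n]≡bl[n] (suc k) = bl[2n+1]-between-suc b

bl-within-suc : ∀ {m} → Binary m → BlWithin 1 m (suc m)
bl-within-suc zero = z≤n , ≤-refl
bl-within-suc (even {k} b) rewrite bl[2n]≡bl[n] k with bl[2n+1]-between b
... | lower , upper = ≤-trans lower (n≤1+n _) , upper
bl-within-suc (odd {k} b) rewrite bl[2n]≡bl[n] (suc k) with bl[2n+1]-between-suc b
... | lower , upper = upper , ≤-trans lower (n≤1+n _)

bl[2n+1]-within-bl[2n+3] : ∀ {n} → Binary n → BlWithin 1 (1 + n * 2) (1 + suc n * 2)
bl[2n+1]-within-bl[2n+3] zero = n≤1+n _ , n≤1+n _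
bl[2n+1]-within-bl[2n+3] (even {k} b) rewrite bl[4n+1]≡1+bl[n] k | bl[4n+3]≡bl[2n+1] k with bl[2n+1]-between b
... | lower , upper = s≤s lower , ≤-trans upper (n≤1+n _)
bl[2n+1]-within-bl[2n+3] (odd {k} b)
  rewrite bl[4n+3]≡bl[2n+1] k | bl[4n+1]≡1+bl[n] (suc k) with bl[2n+1]-between-suc b
... | lower , upper = ≤-trans upper (n≤1+n _) , s≤s lower

2n+2^[1+y]≡[n+2^y]*2 : ∀ n y → n * 2 + 2 ^ suc y ≡ (n + 2 ^ y) * 2
2n+2^[1+y]≡[n+2^y]*2 n y = begin
  n * 2 + 2 * 2 ^ y  ≡⟨ cong (_+_ (n * 2)) (*-comm 2 (2 ^ y)) ⟩
  n * 2 + 2 ^ y * 2  ≡⟨ sym (*-distribʳ-+ 2 n (2 ^ y)) ⟩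
  (n + 2 ^ y) * 2    ∎
  where open ≡-Reasoning

bl-within-+2^ : ∀ y m → BlWithin 1 m (m + 2 ^ y)
bl[2n]-within-+2^ : ∀ y n → BlWithin 1 (n * 2) (n * 2 + 2 ^ suc y)
bl[2n+1]-within-+2^ : ∀ y {n} → Binary n → BlWithin 1 (1 + n * 2) (1 + (n + 2 ^ y) * 2)
bl[4n+1]-within-+2^ : ∀ y n → BlWithin 1 (1 + n * 2 * 2) (1 + (n * 2 + 2 ^ suc y) * 2)

bl-within-+2^ zero m rewrite +-comm m 1 = bl-within-suc (binary m)
bl-within-+2^ (suc y) m with binary m
... | zero       = bl[2n]-within-+2^ y 0
... | even {n} _ = bl[2n]-within-+2^ y n
... | odd {n} b  =
  subst (λ z → BlWithin 1 (1 + n * 2) (suc z)) (sym (2n+2^[1+y]≡[n+2^y]*2 n y)) (bl[2n+1]-within-+2^ y b)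

bl[2n]-within-+2^ y n =
  subst (BlWithin 1 (n * 2)) (sym (2n+2^[1+y]≡[n+2^y]*2 n y)) (within-2n {a = n} {n + 2 ^ y} (bl-within-+2^ y n))

bl[2n+1]-within-+2^ zero {n} b rewrite +-comm n 1 = bl[2n+1]-within-bl[2n+3] b
bl[2n+1]-within-+2^ (suc y) zero         = bl[4n+1]-within-+2^ y 0
bl[2n+1]-within-+2^ (suc y) (even {j} _) = bl[4n+1]-within-+2^ y j
bl[2n+1]-within-+2^ (suc y) (odd {j} b)  =
  subst (λ z → BlWithin 1 (1 + (1 + j * 2) * 2) (1 + suc z * 2)) (sym (2n+2^[1+y]≡[n+2^y]*2 j y))
        (within-4n+3 {a = j} {j + 2 ^ y} (bl[2n+1]-within-+2^ y b))

bl[4n+1]-within-+2^ y n =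
  subst (λ z → BlWithin 1 (1 + n * 2 * 2) (1 + z * 2)) (sym (2n+2^[1+y]≡[n+2^y]*2 n y))
        (within-4n+1 {a = n} {n + 2 ^ y} (bl-within-+2^ y n))

negOnePow*a≡±a : ∀ x a → negOnePow x ℤ.* + a ≡ + a ⊎ negOnePow x ℤ.* + a ≡ ℤ.- + a
negOnePow*a≡±a zero    a = inj₁ (ℤ.*-identityˡ (+ a))
negOnePow*a≡±a (suc x) a with negOnePow*a≡±a x a
... | inj₁ e = inj₂ (trans (sym (ℤ.neg-distribˡ-* (negOnePow x) (+ a))) (cong ℤ.-_ e))
... | inj₂ e = inj₁ (trans (sym (ℤ.neg-distribˡ-* (negOnePow x) (+ a)))
                          (trans (cong ℤ.-_ e) (ℤ.neg-involutive (+ a))))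

+m+[+a+r]≡+k⇒+[m+a]+r≡+k : ∀ m a r k → + m ℤ.+ (+ a ℤ.+ r) ≡ + k → + (m + a) ℤ.+ r ≡ + k
+m+[+a+r]≡+k⇒+[m+a]+r≡+k m a r k h = begin
  + (m + a) ℤ.+ r          ≡⟨ cong (ℤ._+ r) (ℤ.pos-+ m a) ⟩
  + m ℤ.+ + a ℤ.+ r        ≡⟨ ℤ.+-assoc (+ m) (+ a) r ⟩
  + m ℤ.+ (+ a ℤ.+ r)      ≡⟨ h ⟩
  + k                      ∎
  where open ≡-Reasoning

+m+[-a+r]≡+k⇒+m+r≡+[k+a] : ∀ m a r k → + m ℤ.+ (ℤ.- + a ℤ.+ r) ≡ + k → + m ℤ.+ r ≡ + (k + a)
+m+[-a+r]≡+k⇒+m+r≡+[k+a] m a r k h = begin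
  + m ℤ.+ r                           ≡⟨ regroup (+ m) (+ a) r ⟩
  + m ℤ.+ (ℤ.- + a ℤ.+ r) ℤ.+ + a     ≡⟨ cong (ℤ._+ + a) h ⟩
  + k ℤ.+ + a                         ≡⟨ sym (ℤ.pos-+ k a) ⟩
  + (k + a)                           ∎
  where
  open ≡-Reasoning
  open +-*-Solver
  regroup : ∀ m a r → m ℤ.+ r ≡ m ℤ.+ (ℤ.- a ℤ.+ r) ℤ.+ a
  regroup = solve 3 (λ m a r → m :+ r := m :+ (:- a :+ r) :+ a) refl

-- Partial sums may be negative, so a term -2^y is moved to the other side as +2^y added to k.
signedPowSum-within : ∀ t (x y : Fin t → ℕ) m k → + m ℤ.+ signedPowSum t x y ≡ + k → BlWithin t m k
signedPowSum-within zero    x y m k h =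
  subst (BlWithin 0 m) (ℤ.+-injective (trans (sym (ℤ.+-identityʳ (+ m))) h)) (within-refl m)
signedPowSum-within (suc t) x y m k h = by-sign (negOnePow*a≡±a (x fz) a)
  where
  a = 2 ^ y fz
  r = signedPowSum t (x ∘ fs) (y ∘ fs)
  h[_] : ∀ {s} → negOnePow (x fz) ℤ.* + a ≡ s → + m ℤ.+ (s ℤ.+ r) ≡ + k
  h[ e ] = subst (λ s → + m ℤ.+ (s ℤ.+ r) ≡ + k) e h
  by-sign : negOnePow (x fz) ℤ.* + a ≡ + a ⊎ negOnePow (x fz) ℤ.* + a ≡ ℤ.- + a → BlWithin (suc t) m k
  by-sign (inj₁ e) =
    within-trans {1} {t} {m} {m + a} {k} (bl-within-+2^ (y fz) m)
      (signedPowSum-within t (x ∘ fs) (y ∘ fs) (m + a) k (+m+[+a+r]≡+k⇒+[m+a]+r≡+k m a r k h[ e ]))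
  by-sign (inj₂ e) =
    within-sym {suc t} {k} {m} (within-trans {1} {t} {k} {k + a} {m} (bl-within-+2^ (y fz) k)
      (within-sym {t} {m} {k + a}
        (signedPowSum-within t (x ∘ fs) (y ∘ fs) m (k + a) (+m+[-a+r]≡+k⇒+m+r≡+[k+a] m a r k h[ e ]))))

mainTheorem4 : (t : ℕ) → t ≥ 1 → (x y : Fin t → ℕ) → (k : ℕ) → k ≥ 1 →
    signedPowSum t x y ≡ + k → bl k ≤ t
mainTheorem4 t _ x y k _ h with signedPowSum-within t x y 0 k (trans (ℤ.+-identityˡ _) h)
... | _ , bl[k]≤t+0 = subst (bl k ≤_) (+-identityʳ t) bl[k]≤t+0
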